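{- Let $P=(X,<)$ be a finite poset and let $\mathcal{A},\mathcal{C}$ be an orthogonal pair of $P$. Let $P_{\mathcal{A}}$ be the order induced by $P$ on $X_{\mathcal{A}}=\bigcup\{A: A\in\mathcal{A}\}$, and let $\mathcal{A}'$ be the canonical antichain partition of $P_{\mathcal{A}}$. Then $\mathcal{A}',\mathcal{C}$ is again an orthogonal pair of $P$.
   Context: An antichain family is a family of pairwise disjoint antichains of $P$; a chain family is a family of pairwise disjoint chains of $P$. A chain family $\mathcal{C}$ and an antichain family $\mathcal{A}$ form an orthogonal pair if (1) $X=\bigl(\bigcup_{A\in\mathcal{A}}A\bigr)\cup\bigl(\bigcup_{C\in\mathcal{C}}C\bigr)$, and (2) $|A\cap C|=1$ for all $A\in\mathcal{A}$, $C\in\mathcal{C}$. The canonical antichain partition of a finite poset $(Y,<)$ is the sequence $A_1,A_2,\dots,A_h$ of nonempty sets with $A_1=\mathrm{Min}(Y)$ and $A_j=\mathrm{Min}\bigl(Y\setminus\bigcup_{i<j}A_i\bigr)$ for $j>1$, continued until all of $Y$ is exhausted ($\mathrm{Min}$ denotes the set of minimal elements). -}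

module Defs where

open import Data.Nat using (ℕ)
open import Data.Bool using (Bool; true; false; _∧_; not)
open import Data.Fin using (Fin)
open import Data.Fin.Properties using () renaming (any? to anyFin?)
open import Data.Fin.Subset using (Subset; _∈_; _∩_; _─_; ∣_∣; Nonempty; Empty)
open import Data.Fin.Subset.Properties using (_∈?_)
open import Data.Vec using (tabulate)
open import Data.Product using (_×_; ∃)
open import Relation.Nullary using (¬_; does)
open import Relation.Nullary.Decidable using (_×-dec_)
open import Relation.Binary using (Decidable)
open import Relation.Binary.PropositionalEquality using (_≡_)
open import Data.List using (List; []; _∷_)
open import Data.List.Membership.Propositional using () renaming (_∈_ to _∈ₗ_)
open import Data.List.Relation.Unary.Any using (Any) renaming (any? to anyList?)
open import Data.List.Relation.Unary.AllPairs using (AllPairs)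
open import Data.Sum using (_⊎_)
open import Data.Empty using (⊥)

record FinPoset (n : ℕ) : Set₁ where
  field
    _<_      : Fin n → Fin n → Set
    <-irrefl : ∀ x → ¬ (x < x)
    <-trans  : ∀ {x y z} → x < y → y < z → x < z
    _<?_     : Decidable _<_

module _ {n : ℕ} (P : FinPoset n) where
  open FinPoset P

  Comparable : Fin n → Fin n → Set
  Comparable x y = x ≡ y ⊎ (x < y ⊎ y < x)

  IsChain : Subset n → Set
  IsChain S = ∀ x y → x ∈ S → y ∈ S → Comparable x y

  IsAntichain : Subset n → Set
  IsAntichain S = ∀ x y → x ∈ S → y ∈ S → ¬ (x < y)

  Disjoint : Subset n → Subset n → Set
  Disjoint S T = ∀ x → x ∈ S → x ∈ T → ⊥

  IsAntichainFamily : List (Subset n) → Set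
  IsAntichainFamily 𝒜 = (∀ A → A ∈ₗ 𝒜 → IsAntichain A) × AllPairs Disjoint 𝒜

  IsChainFamily : List (Subset n) → Set
  IsChainFamily 𝒞 = (∀ C → C ∈ₗ 𝒞 → IsChain C) × AllPairs Disjoint 𝒞

  _∈⋃_ : Fin n → List (Subset n) → Set
  x ∈⋃ 𝓕 = Any (x ∈_) 𝓕

  OrthogonalPair : List (Subset n) → List (Subset n) → Set
  OrthogonalPair 𝒜 𝒞 =
    IsAntichainFamily 𝒜 × IsChainFamily 𝒞 ×
    (∀ x → (x ∈⋃ 𝒜) ⊎ (x ∈⋃ 𝒞)) ×
    (∀ A C → A ∈ₗ 𝒜 → C ∈ₗ 𝒞 → ∣ A ∩ C ∣ ≡ 1)

  ⋃ : List (Subset n) → Subset n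
  ⋃ 𝓕 = tabulate (λ x → does (any?' x))
    where
    any?' : ∀ x → _
    any?' x = anyList? (x ∈?_) 𝓕

  Min : Subset n → Subset n
  Min Y = tabulate (λ x → does (x ∈? Y) ∧ not (does (anyFin? (λ y → (y ∈? Y) ×-dec (y <? x)))))

  data IsCanonicalPartition : Subset n → List (Subset n) → Set where
    done : ∀ {Y} → Empty Y → IsCanonicalPartition Y []
    step : ∀ {Y L} → Nonempty (Min Y) → IsCanonicalPartition (Y ─ Min Y) L →
           IsCanonicalPartition Y (Min Y ∷ L)

-- Let C ∈ 𝒞 and Y = X_𝒜. Every chain meets each antichain of 𝒜 at most once while C
-- meets each of them exactly once, so C ∩ Y is a longest chain of Y. The least element c
-- of C ∩ Y is then minimal in Y (anything below it would lengthen the chain), so C meets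
-- the first level Min Y of the canonical partition in exactly c, these two being elements
-- of a chain and of an antichain. Moreover C ∩ (Y ─ Min Y) is a longest chain of
-- Y ─ Min Y: the least element of a chain S of Y ─ Min Y lies above some element of Y,
-- so |S| + 1 ≤ |C ∩ Y| = 1 + |C ∩ (Y ─ Min Y)|. Induction along the canonical partition
-- shows that C meets every level exactly once.
module Submission where

open import Defs
open import Data.Nat using (ℕ; suc; _+_; _≤_; z≤n; s≤s⁻¹)
open import Data.Nat.Properties using (≤-trans; ≤-antisym; +-mono-≤; n≮n; +-suc)
import Data.Nat.Induction as ℕ
open import Data.Bool using (Bool; T; _∧_; not)
open import Data.Bool.Properties using (T-≡)
open import Data.Fin using (Fin)
open import Data.Fin.Properties using () renaming (any? to anyFin?)
open import Data.Fin.Subset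
  using (Subset; _∈_; _∉_; _∩_; _∪_; _─_; _⊆_; _⊂_; ∣_∣; ⁅_⁆; Nonempty; Empty; inside; outside)
open import Data.Fin.Subset.Properties
  using (_∈?_; ⊆-antisym; x∈p∩q⁺; x∈p∩q⁻; p∩q⊆q; x∈p∪q⁺; x∈p∪q⁻; x∈p∧x∉q⇒x∈p─q; p─q⊆p; p⊆p∪q;
         p∩q⊆p; p⊆q⇒∣p∣≤∣q∣; p⊂q⇒∣p∣<∣q∣; ∣⁅x⁆∣≡1; x∈⁅x⁆; x∈⁅y⁆⇒x≡y; nonempty?; Empty-unique; ∣⊥∣≡0)
open import Data.Vec using ([]; _∷_; here; there; tabulate)
open import Data.Vec.Properties using (lookup∘tabulate; []=⇒lookup; lookup⇒[]=)
open import Data.Product using (_×_; _,_; proj₁; proj₂; ∃)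
open import Data.Sum using (_⊎_; inj₁; inj₂; [_,_])
open import Data.Empty using (⊥-elim)
open import Function using (_∘_; id)
open import Function.Bundles using (Equivalence)
open import Induction.WellFounded using (WellFounded; Acc; acc; module Subrelation)
import Relation.Binary.Construct.On as On
open import Relation.Nullary using (¬_; Dec; does; yes; no)
open import Relation.Nullary.Decidable using (_×-dec_; toWitness; fromWitness; isYes≗does)
open import Relation.Binary.PropositionalEquality using (_≡_; refl; sym; trans; cong; cong₂; subst)
open import Data.List using (List; []; _∷_)
open import Data.List.Membership.Propositional using () renaming (_∈_ to _∈ₗ_)
open import Data.List.Relation.Unary.Any using (Any; here; there) renaming (any? to anyList?)
open import Data.List.Relation.Unary.Any.Properties using (¬Any[])
open import Data.List.Relation.Unary.All as All using (All; _∷_)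
open import Data.List.Relation.Unary.AllPairs using (AllPairs; []; _∷_)

private
  variable
    n : ℕ
    p q r : Subset n
    x y : Fin n

∈-tabulate⁻ : {f : Fin n → Bool} → x ∈ tabulate f → T (f x)
∈-tabulate⁻ {x = x} {f} x∈ =
  Equivalence.from T-≡ (trans (sym (lookup∘tabulate f x)) ([]=⇒lookup x∈))

∈-tabulate⁺ : {f : Fin n → Bool} → T (f x) → x ∈ tabulate f
∈-tabulate⁺ {x = x} {f} fx =
  lookup⇒[]= x (tabulate f) (trans (lookup∘tabulate f x) (Equivalence.to T-≡ fx))

∈-tabulate-does⁻ : {Q : Fin n → Set} (Q? : ∀ x → Dec (Q x)) → x ∈ tabulate (does ∘ Q?) → Q x
∈-tabulate-does⁻ {x = x} Q? x∈ = toWitness (subst T (sym (isYes≗does (Q? x))) (∈-tabulate⁻ x∈))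

∈-tabulate-does⁺ : {Q : Fin n → Set} (Q? : ∀ x → Dec (Q x)) → Q x → x ∈ tabulate (does ∘ Q?)
∈-tabulate-does⁺ {x = x} Q? q = ∈-tabulate⁺ (subst T (isYes≗does (Q? x)) (fromWitness q))

x∈p─q⇒x∉q : x ∈ p ─ q → x ∉ q
x∈p─q⇒x∉q {p = _ ∷ _} {inside ∷ _}  ()        here
x∈p─q⇒x∉q {p = _ ∷ p} {_ ∷ q}       (there x∈) (there x∈q) =
  x∈p─q⇒x∉q {p = p} {q} x∈ x∈q

∣p∣≡∣p∩q∣+∣p─q∣ : ∀ (p q : Subset n) → ∣ p ∣ ≡ ∣ p ∩ q ∣ + ∣ p ─ q ∣
∣p∣≡∣p∩q∣+∣p─q∣ []            []            = refl
∣p∣≡∣p∩q∣+∣p─q∣ (inside ∷ p)  (inside ∷ q)  = cong suc (∣p∣≡∣p∩q∣+∣p─q∣ p q)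
∣p∣≡∣p∩q∣+∣p─q∣ (inside ∷ p)  (outside ∷ q) =
  trans (cong suc (∣p∣≡∣p∩q∣+∣p─q∣ p q)) (sym (+-suc _ _))
∣p∣≡∣p∩q∣+∣p─q∣ (outside ∷ p) (inside ∷ q)  = ∣p∣≡∣p∩q∣+∣p─q∣ p q
∣p∣≡∣p∩q∣+∣p─q∣ (outside ∷ p) (outside ∷ q) = ∣p∣≡∣p∩q∣+∣p─q∣ p q

p⊆q⇒q∩p≡p : p ⊆ q → q ∩ p ≡ p
p⊆q⇒q∩p≡p {p = p} {q} p⊆q = ⊆-antisym (p∩q⊆q q p) (λ x∈p → x∈p∩q⁺ (p⊆q x∈p , x∈p))

partition⇒∣p∣≡∣q∣+∣r∣ : q ⊆ p → r ⊆ p → (∀ {x} → x ∈ p → x ∈ q ⊎ x ∈ r) →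
                        (∀ {x} → x ∈ q → x ∉ r) → ∣ p ∣ ≡ ∣ q ∣ + ∣ r ∣
partition⇒∣p∣≡∣q∣+∣r∣ {q = q} {p} {r} q⊆p r⊆p cover disjoint =
  trans (∣p∣≡∣p∩q∣+∣p─q∣ p q) (cong₂ _+_ (cong ∣_∣ (p⊆q⇒q∩p≡p q⊆p)) (cong ∣_∣ p─q≡r))
  where
  p─q≡r : p ─ q ≡ r
  p─q≡r = ⊆-antisym
    (λ x∈p─q → [ ⊥-elim ∘ x∈p─q⇒x∉q x∈p─q , id ] (cover (p─q⊆p p q x∈p─q)))
    (λ x∈r → x∈p∧x∉q⇒x∈p─q (r⊆p x∈r) (λ x∈q → disjoint x∈q x∈r))

Empty⇒∣p∣≡0 : Empty p → ∣ p ∣ ≡ 0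
Empty⇒∣p∣≡0 {n} empty = trans (cong ∣_∣ (Empty-unique empty)) (∣⊥∣≡0 n)

1≤∣p∣⇒Nonempty : 1 ≤ ∣ p ∣ → Nonempty p
1≤∣p∣⇒Nonempty {p = p} 1≤∣p∣ with nonempty? p
... | yes nonempty = nonempty
... | no empty with subst (1 ≤_) (Empty⇒∣p∣≡0 empty) 1≤∣p∣
...   | ()

x∈p⇒⁅x⁆⊆p : x ∈ p → ⁅ x ⁆ ⊆ p
x∈p⇒⁅x⁆⊆p {x = x} {p} x∈p y∈⁅x⁆ = subst (_∈ p) (sym (x∈⁅y⁆⇒x≡y x y∈⁅x⁆)) x∈p

x∈p⇒1≤∣p∣ : x ∈ p → 1 ≤ ∣ p ∣
x∈p⇒1≤∣p∣ {x = x} x∈p = subst (_≤ _) (∣⁅x⁆∣≡1 x) (p⊆q⇒∣p∣≤∣q∣ (x∈p⇒⁅x⁆⊆p x∈p))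

∣p∣≤1 : (∀ {x y} → x ∈ p → y ∈ p → x ≡ y) → ∣ p ∣ ≤ 1
∣p∣≤1 {p = p} unique with nonempty? p
... | no empty = subst (_≤ 1) (sym (Empty⇒∣p∣≡0 empty)) z≤n
... | yes (x , x∈p) = subst (∣ p ∣ ≤_) (∣⁅x⁆∣≡1 x)
  (p⊆q⇒∣p∣≤∣q∣ (λ y∈p → subst (_∈ ⁅ x ⁆) (unique x∈p y∈p) (x∈⁅x⁆ x)))

module _ {n : ℕ} (P : FinPoset n) where
  open FinPoset P

  private
    variable
      S Y : Subset n
      𝓕 : List (Subset n)

  MinimalIn : Subset n → Fin n → Set
  MinimalIn Y x = x ∈ Y × (∀ {y} → y ∈ Y → ¬ y < x)

  private
    BelowIn : Subset n → Fin n → Set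
    BelowIn Y x = ∃ λ y → y ∈ Y × y < x

    minimal⁻ : (x∈Y? : Dec (x ∈ Y)) (below? : Dec (BelowIn Y x)) →
               T (does x∈Y? ∧ not (does below?)) → MinimalIn Y x
    minimal⁻ (yes x∈Y) (no noneBelow) _ = x∈Y , λ y∈Y y<x → noneBelow (_ , y∈Y , y<x)

    minimal⁺ : (x∈Y? : Dec (x ∈ Y)) (below? : Dec (BelowIn Y x)) →
               MinimalIn Y x → T (does x∈Y? ∧ not (does below?))
    minimal⁺ (yes _)  (no _)                _             = _
    minimal⁺ (yes _)  (yes (_ , y∈Y , y<x)) (_ , minimal) = minimal y∈Y y<x
    minimal⁺ (no x∉Y) _                     (x∈Y , _)     = x∉Y x∈Y

    below? : ∀ Y x → Dec (BelowIn Y x)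
    below? Y x = anyFin? (λ y → (y ∈? Y) ×-dec (y <? x))

  ∈-Min⁻ : x ∈ Min P Y → MinimalIn Y x
  ∈-Min⁻ {x = x} {Y} x∈Min = minimal⁻ (x ∈? Y) (below? Y x) (∈-tabulate⁻ x∈Min)

  ∈-Min⁺ : MinimalIn Y x → x ∈ Min P Y
  ∈-Min⁺ {Y = Y} {x} minimal = ∈-tabulate⁺ (minimal⁺ (x ∈? Y) (below? Y x) minimal)

  Min⊆ : Min P Y ⊆ Y
  Min⊆ = proj₁ ∘ ∈-Min⁻

  ∉-Min⇒∃below : x ∈ Y → x ∉ Min P Y → ∃ λ y → y ∈ Y × y < x
  ∉-Min⇒∃below {x = x} {Y} x∈Y x∉Min with below? Y x
  ... | yes below = below
  ... | no noneBelow = ⊥-elim (x∉Min (∈-Min⁺ (x∈Y , λ y∈Y y<x → noneBelow (_ , y∈Y , y<x))))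

  Min-antichain : IsAntichain P (Min P Y)
  Min-antichain x y x∈Min y∈Min = proj₂ (∈-Min⁻ y∈Min) (Min⊆ x∈Min)

  ↓ : Fin n → Subset n
  ↓ x = tabulate (does ∘ (_<? x))

  <⇒↓⊂↓ : y < x → ↓ y ⊂ ↓ x
  <⇒↓⊂↓ {y} {x} y<x =
    (λ z∈↓y → ∈-tabulate-does⁺ (_<? x) (<-trans (∈-tabulate-does⁻ (_<? y) z∈↓y) y<x)) ,
    y , ∈-tabulate-does⁺ (_<? x) y<x , <-irrefl y ∘ ∈-tabulate-does⁻ (_<? y)

  <-wellFounded : WellFounded _<_
  <-wellFounded =
    Subrelation.wellFounded (p⊂q⇒∣p∣<∣q∣ ∘ <⇒↓⊂↓) (On.wellFounded (∣_∣ ∘ ↓) ℕ.<-wellFounded)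

  Min-nonempty : Nonempty Y → Nonempty (Min P Y)
  Min-nonempty {Y} (x , x∈Y) = descend (<-wellFounded x) x∈Y
    where
    descend : ∀ {x} → Acc _<_ x → x ∈ Y → Nonempty (Min P Y)
    descend {x} (acc smaller) x∈Y with x ∈? Min P Y
    ... | yes x∈Min = x , x∈Min
    ... | no x∉Min with ∉-Min⇒∃below x∈Y x∉Min
    ...   | y , y∈Y , y<x = descend (smaller y<x) y∈Y

  ⁅x⁆-chain : IsChain P ⁅ x ⁆
  ⁅x⁆-chain {x = x} a b a∈ b∈ = inj₁ (trans (x∈⁅y⁆⇒x≡y x a∈) (sym (x∈⁅y⁆⇒x≡y x b∈)))

  ∩-chain : ∀ Y {C} → IsChain P C → IsChain P (Y ∩ C)
  ∩-chain Y {C} chain x y x∈ y∈ = chain x y (proj₂ (x∈p∩q⁻ Y C x∈)) (proj₂ (x∈p∩q⁻ Y C y∈))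

  ∣antichain∩chain∣≤1 : ∀ {A S} → IsAntichain P A → IsChain P S → ∣ A ∩ S ∣ ≤ 1
  ∣antichain∩chain∣≤1 {A} {S} antichain chain = ∣p∣≤1 λ {x} {y} x∈ y∈ →
    let x∈A , x∈S = x∈p∩q⁻ A S x∈
        y∈A , y∈S = x∈p∩q⁻ A S y∈
    in incomparable (chain x y x∈S y∈S) (antichain x y x∈A y∈A) (antichain y x y∈A x∈A)
    where
    incomparable : ∀ {x y} → Comparable P x y → ¬ x < y → ¬ y < x → x ≡ y
    incomparable (inj₁ x≡y)        _   _   = x≡y
    incomparable (inj₂ (inj₁ x<y)) x≮y _   = ⊥-elim (x≮y x<y)
    incomparable (inj₂ (inj₂ y<x)) _   y≮x = ⊥-elim (y≮x y<x)

  Min-chain-least : ∀ {s u} → IsChain P S → s ∈ Min P S → u ∈ S → s ≡ u ⊎ s < u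
  Min-chain-least {S} {s} {u} chain s∈Min u∈S with chain s u (Min⊆ s∈Min) u∈S
  ... | inj₁ s≡u        = inj₁ s≡u
  ... | inj₂ (inj₁ s<u) = inj₂ s<u
  ... | inj₂ (inj₂ u<s) = ⊥-elim (proj₂ (∈-Min⁻ s∈Min) u∈S u<s)

  chain-∪-below : IsChain P S → (∀ {u} → u ∈ S → y < u) → IsChain P (S ∪ ⁅ y ⁆)
  chain-∪-below {S} {y} chain below a b a∈ b∈ with x∈p∪q⁻ S ⁅ y ⁆ a∈ | x∈p∪q⁻ S ⁅ y ⁆ b∈
  ... | inj₁ a∈S | inj₁ b∈S = chain a b a∈S b∈S
  ... | inj₂ a∈y | inj₁ b∈S rewrite x∈⁅y⁆⇒x≡y y a∈y = inj₂ (inj₁ (below b∈S))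
  ... | inj₁ a∈S | inj₂ b∈y rewrite x∈⁅y⁆⇒x≡y y b∈y = inj₂ (inj₂ (below a∈S))
  ... | inj₂ a∈y | inj₂ b∈y = inj₁ (trans (x∈⁅y⁆⇒x≡y y a∈y) (sym (x∈⁅y⁆⇒x≡y y b∈y)))

  ChainsBoundedBy : Subset n → ℕ → Set
  ChainsBoundedBy Y k = ∀ {S} → IsChain P S → S ⊆ Y → ∣ S ∣ ≤ k

  below-Min-chain⇒suc≤ : ∀ {k s} → ChainsBoundedBy Y k → IsChain P S → S ⊆ Y →
                         s ∈ Min P S → y ∈ Y → y < s → suc ∣ S ∣ ≤ k
  below-Min-chain⇒suc≤ {Y} {S} {y} bound chain S⊆Y s∈Min y∈Y y<s =
    ≤-trans (p⊂q⇒∣p∣<∣q∣ S⊂S∪y) (bound (chain-∪-below chain below) S∪y⊆Y)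
    where
    below : ∀ {u} → u ∈ S → y < u
    below u∈S = [ (λ { refl → y<s }) , <-trans y<s ] (Min-chain-least chain s∈Min u∈S)
    S⊂S∪y : S ⊂ S ∪ ⁅ y ⁆
    S⊂S∪y = p⊆p∪q ⁅ y ⁆ , y , x∈p∪q⁺ (inj₂ (x∈⁅x⁆ y)) , λ y∈S → <-irrefl y (below y∈S)
    S∪y⊆Y : S ∪ ⁅ y ⁆ ⊆ Y
    S∪y⊆Y x∈ = [ S⊆Y , x∈p⇒⁅x⁆⊆p y∈Y ] (x∈p∪q⁻ S ⁅ y ⁆ x∈)

  module _ {C Y : Subset n} (chain : IsChain P C) (bound : ChainsBoundedBy Y ∣ Y ∩ C ∣) where

    longest-chain-meets-Min : Nonempty Y → ∃ λ c → c ∈ Min P Y × c ∈ C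
    longest-chain-meets-Min (z , z∈Y) = c , ∈-Min⁺ (c∈Y , c-minimal) , c∈C
      where
      Y∩C-nonempty : Nonempty (Y ∩ C)
      Y∩C-nonempty = 1≤∣p∣⇒Nonempty
        (subst (_≤ _) (∣⁅x⁆∣≡1 z) (bound ⁅x⁆-chain (x∈p⇒⁅x⁆⊆p z∈Y)))
      c = proj₁ (Min-nonempty Y∩C-nonempty)
      c∈Min = proj₂ (Min-nonempty Y∩C-nonempty)
      c∈Y = proj₁ (x∈p∩q⁻ Y C (Min⊆ c∈Min))
      c∈C = proj₂ (x∈p∩q⁻ Y C (Min⊆ c∈Min))
      c-minimal : ∀ {y} → y ∈ Y → ¬ y < c
      c-minimal y∈Y y<c =
        n≮n _ (below-Min-chain⇒suc≤ bound (∩-chain Y chain) (p∩q⊆p Y C) c∈Min y∈Y y<c)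

    ∣Min∩C∣≡1 : Nonempty Y → ∣ Min P Y ∩ C ∣ ≡ 1
    ∣Min∩C∣≡1 nonempty =
      let c , c∈Min , c∈C = longest-chain-meets-Min nonempty in
      ≤-antisym (∣antichain∩chain∣≤1 Min-antichain chain) (x∈p⇒1≤∣p∣ (x∈p∩q⁺ (c∈Min , c∈C)))

    ∣Y∩C∣≡1+∣Y─Min∩C∣ : Nonempty Y → ∣ Y ∩ C ∣ ≡ suc ∣ (Y ─ Min P Y) ∩ C ∣
    ∣Y∩C∣≡1+∣Y─Min∩C∣ nonempty =
      trans (partition⇒∣p∣≡∣q∣+∣r∣ Min∩C⊆ Y─Min∩C⊆ cover disjoint)
            (cong (_+ ∣ (Y ─ Min P Y) ∩ C ∣) (∣Min∩C∣≡1 nonempty))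
      where
      Min∩C⊆ : Min P Y ∩ C ⊆ Y ∩ C
      Min∩C⊆ x∈ = let x∈Min , x∈C = x∈p∩q⁻ _ C x∈ in x∈p∩q⁺ (Min⊆ x∈Min , x∈C)
      Y─Min∩C⊆ : (Y ─ Min P Y) ∩ C ⊆ Y ∩ C
      Y─Min∩C⊆ x∈ = let x∈Y─Min , x∈C = x∈p∩q⁻ _ C x∈ in x∈p∩q⁺ (p─q⊆p Y _ x∈Y─Min , x∈C)
      cover : ∀ {x} → x ∈ Y ∩ C → x ∈ Min P Y ∩ C ⊎ x ∈ (Y ─ Min P Y) ∩ C
      cover {x} x∈ with x∈p∩q⁻ Y C x∈ | x ∈? Min P Y
      ... | _   , x∈C | yes x∈Min = inj₁ (x∈p∩q⁺ (x∈Min , x∈C))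
      ... | x∈Y , x∈C | no x∉Min  = inj₂ (x∈p∩q⁺ (x∈p∧x∉q⇒x∈p─q x∈Y x∉Min , x∈C))
      disjoint : ∀ {x} → x ∈ Min P Y ∩ C → x ∉ (Y ─ Min P Y) ∩ C
      disjoint x∈ x∈′ = x∈p─q⇒x∉q (proj₁ (x∈p∩q⁻ _ C x∈′)) (proj₁ (x∈p∩q⁻ _ C x∈))

    ─Min-bound : Nonempty Y → ChainsBoundedBy (Y ─ Min P Y) ∣ (Y ─ Min P Y) ∩ C ∣
    ─Min-bound nonempty {S} chainS S⊆Y─Min with nonempty? S
    ... | no empty = subst (_≤ _) (sym (Empty⇒∣p∣≡0 empty)) z≤n
    ... | yes nonemptyS =
      let s , s∈Min = Min-nonempty nonemptyS
          s∈Y─Min = S⊆Y─Min (Min⊆ s∈Min)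
          y , y∈Y , y<s = ∉-Min⇒∃below (p─q⊆p Y _ s∈Y─Min) (x∈p─q⇒x∉q s∈Y─Min)
      in s≤s⁻¹ (subst (suc ∣ S ∣ ≤_) (∣Y∩C∣≡1+∣Y─Min∩C∣ nonempty)
           (below-Min-chain⇒suc≤ bound chainS (p─q⊆p Y _ ∘ S⊆Y─Min) s∈Min y∈Y y<s))

  canonical-levels-meet-chain : ∀ {C Y L} → IsChain P C → IsCanonicalPartition P Y L →
                                ChainsBoundedBy Y ∣ Y ∩ C ∣ → ∀ {A} → A ∈ₗ L → ∣ A ∩ C ∣ ≡ 1
  canonical-levels-meet-chain chain (step (z , z∈Min) _) bound (here refl) =
    ∣Min∩C∣≡1 chain bound (z , Min⊆ z∈Min)
  canonical-levels-meet-chain chain (step (z , z∈Min) rest) bound (there A∈L) =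
    canonical-levels-meet-chain chain rest (─Min-bound chain bound (z , Min⊆ z∈Min)) A∈L

  canonical-level⊆ : ∀ {L A} → IsCanonicalPartition P Y L → A ∈ₗ L → A ⊆ Y
  canonical-level⊆ (step _ _) (here refl) = Min⊆
  canonical-level⊆ {Y} (step _ rest) (there A∈L) = p─q⊆p Y _ ∘ canonical-level⊆ rest A∈L

  canonical-antichain : ∀ {L A} → IsCanonicalPartition P Y L → A ∈ₗ L → IsAntichain P A
  canonical-antichain (step _ _) (here refl) = Min-antichain
  canonical-antichain (step _ rest) (there A∈L) = canonical-antichain rest A∈L

  canonical-disjoint : ∀ {L} → IsCanonicalPartition P Y L → AllPairs (Disjoint P) L
  canonical-disjoint (done _) = []
  canonical-disjoint (step _ rest) =
    All.tabulate (λ A∈L x x∈Min x∈A → x∈p─q⇒x∉q (canonical-level⊆ rest A∈L x∈A) x∈Min) ∷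
    canonical-disjoint rest

  canonical-covers : ∀ {L} → IsCanonicalPartition P Y L → x ∈ Y → Any (x ∈_) L
  canonical-covers {x = x} (done empty) x∈Y = ⊥-elim (empty (x , x∈Y))
  canonical-covers {Y} {x = x} (step _ rest) x∈Y with x ∈? Min P Y
  ... | yes x∈Min = here x∈Min
  ... | no x∉Min = there (canonical-covers rest (x∈p∧x∉q⇒x∈p─q x∈Y x∉Min))

  ∈-⋃⁻ : x ∈ ⋃ P 𝓕 → Any (x ∈_) 𝓕
  ∈-⋃⁻ {𝓕 = 𝓕} = ∈-tabulate-does⁻ (λ x → anyList? (x ∈?_) 𝓕)

  ∈-⋃⁺ : Any (x ∈_) 𝓕 → x ∈ ⋃ P 𝓕
  ∈-⋃⁺ {𝓕 = 𝓕} = ∈-tabulate-does⁺ (λ x → anyList? (x ∈?_) 𝓕)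

  ∣⋃∷∩p∣≡∣∩p∣+∣⋃∩p∣ : ∀ {F} p → All (Disjoint P F) 𝓕 →
                      ∣ ⋃ P (F ∷ 𝓕) ∩ p ∣ ≡ ∣ F ∩ p ∣ + ∣ ⋃ P 𝓕 ∩ p ∣
  ∣⋃∷∩p∣≡∣∩p∣+∣⋃∩p∣ {𝓕} {F} p F-disjoint = partition⇒∣p∣≡∣q∣+∣r∣ F∩p⊆ ⋃∩p⊆ cover disjoint
    where
    F∩p⊆ : F ∩ p ⊆ ⋃ P (F ∷ 𝓕) ∩ p
    F∩p⊆ x∈ = let x∈F , x∈p = x∈p∩q⁻ F p x∈ in x∈p∩q⁺ (∈-⋃⁺ {𝓕 = F ∷ 𝓕} (here x∈F) , x∈p)
    ⋃∩p⊆ : ⋃ P 𝓕 ∩ p ⊆ ⋃ P (F ∷ 𝓕) ∩ p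
    ⋃∩p⊆ x∈ = let x∈⋃ , x∈p = x∈p∩q⁻ _ p x∈ in x∈p∩q⁺ (∈-⋃⁺ {𝓕 = F ∷ 𝓕} (there (∈-⋃⁻ x∈⋃)) , x∈p)
    cover : ∀ {x} → x ∈ ⋃ P (F ∷ 𝓕) ∩ p → x ∈ F ∩ p ⊎ x ∈ ⋃ P 𝓕 ∩ p
    cover x∈ with x∈p∩q⁻ _ p x∈
    ... | x∈⋃ , x∈p with ∈-⋃⁻ {𝓕 = F ∷ 𝓕} x∈⋃
    ...   | here x∈F = inj₁ (x∈p∩q⁺ (x∈F , x∈p))
    ...   | there x∈⋃𝓕 = inj₂ (x∈p∩q⁺ (∈-⋃⁺ x∈⋃𝓕 , x∈p))
    disjoint : ∀ {x} → x ∈ F ∩ p → x ∉ ⋃ P 𝓕 ∩ p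
    disjoint {x} x∈ x∈′ = All.lookupWith (λ F∩G=∅ x∈G → F∩G=∅ x (proj₁ (x∈p∩q⁻ F p x∈)) x∈G)
      F-disjoint (∈-⋃⁻ (proj₁ (x∈p∩q⁻ _ p x∈′)))

  ⋃∩-mono : ∀ {p q} → AllPairs (Disjoint P) 𝓕 → (∀ {F} → F ∈ₗ 𝓕 → ∣ F ∩ p ∣ ≤ ∣ F ∩ q ∣) →
            ∣ ⋃ P 𝓕 ∩ p ∣ ≤ ∣ ⋃ P 𝓕 ∩ q ∣
  ⋃∩-mono {p = p} [] _ =
    subst (_≤ _) (sym (Empty⇒∣p∣≡0 (λ (_ , x∈) → ¬Any[] (∈-⋃⁻ (proj₁ (x∈p∩q⁻ _ p x∈)))))) z≤n
  ⋃∩-mono {p = p} {q} (F-disjoint ∷ disjoint) mono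
    rewrite ∣⋃∷∩p∣≡∣∩p∣+∣⋃∩p∣ p F-disjoint | ∣⋃∷∩p∣≡∣∩p∣+∣⋃∩p∣ q F-disjoint =
    +-mono-≤ (mono (here refl)) (⋃∩-mono disjoint (mono ∘ there))

  antichain-family-bounds-chains : ∀ {𝒜 C} → IsAntichainFamily P 𝒜 →
    (∀ A → A ∈ₗ 𝒜 → ∣ A ∩ C ∣ ≡ 1) → ChainsBoundedBy (⋃ P 𝒜) ∣ ⋃ P 𝒜 ∩ C ∣
  antichain-family-bounds-chains (antichains , disjoint) meets {S} chain S⊆⋃ =
    subst (_≤ _) (cong ∣_∣ (p⊆q⇒q∩p≡p S⊆⋃))
      (⋃∩-mono disjoint (λ {A} A∈ → subst (_ ≤_) (sym (meets A A∈))
        (∣antichain∩chain∣≤1 (antichains A A∈) chain)))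

lemma1 : (n : ℕ) (P : FinPoset n) (𝒜 𝒞 : List (Subset n)) →
         OrthogonalPair P 𝒜 𝒞 →
         (𝒜′ : List (Subset n)) → IsCanonicalPartition P (⋃ P 𝒜) 𝒜′ →
         OrthogonalPair P 𝒜′ 𝒞
lemma1 n P 𝒜 𝒞 (antichains , chains , covers , meets) 𝒜′ canonical =
  ((λ _ → canonical-antichain P canonical) , canonical-disjoint P canonical) ,
  chains ,
  covers′ ,
  λ A C A∈ C∈ → canonical-levels-meet-chain P (proj₁ chains C C∈) canonical
    (antichain-family-bounds-chains P antichains (λ A′ A′∈ → meets A′ C A′∈ C∈)) A∈
  where
  covers′ : ∀ x → Any (x ∈_) 𝒜′ ⊎ Any (x ∈_) 𝒞
  covers′ x = [ inj₁ ∘ canonical-covers P canonical ∘ ∈-⋃⁺ P , inj₂ ] (covers x)
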